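{- Every one-endpoint-rooted path is PE-inherent.
   Context: Graphs are simple and undirected. A two-rooted graph is a triple $(H,s,t)$ with $H$ a finite graph and $s,t\in V(H)$ not necessarily distinct, with the convention $d_H(s)\le d_H(t)$. A one-endpoint-rooted path is a two-rooted graph $(H,s,t)$ such that $H$ is a path and at least one of $s,t$ is an endpoint of $H$ (by the convention, $s$ is then an endpoint). A copy of $(\hat H,\hat s,\hat t)$ in a graph $G$ is $(H,s,t)$ with $H$ an induced subgraph of $G$ and an isomorphism $\hat H\to H$ mapping $\hat s\mapsto s$, $\hat t\mapsto t$. An extension of such a copy in $G$ is $(H',s',t')$ with $H'$ an induced subgraph of $G$, $V(H')=V(H)\cup\{s',t'\}$, $s'\ne t'$ not in $V(H)$, $H'-\{s',t'\}=H$, and $s$ (resp. $t$) the unique neighbour of $s'$ (resp. $t'$) in $H'$. A copy is simplicial if it has no extension. Given a simplicial copy $(H,s,t)$ in $G$, a pendant extension (PE) of $G$ with respect to it is any graph obtained from $G$ by adding the minimum number of pendant edges (to new vertices) at $s$ and/or $t$ so that $(H,s,t)$ becomes non-simplicial. A PE-sequence of $(\hat H,\hat s,\hat t)$ is a finite or infinite sequence $(G_i)_{i\ge0}$ with $G_0=\hat H$ where, if $G_i$ contains a simplicial copy of $(\hat H,\hat s,\hat t)$, $G_{i+1}$ is a PE of $G_i$ with respect to some simplicial copy, and otherwise the sequence ends at $G_i$. A two-rooted graph is PE-inherent if all of its PE-sequences are infinite. -}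

module Defs where

open import Data.Nat using (ℕ; zero; suc; _+_; _≤_; _<_)
open import Data.Fin using (Fin; toℕ; splitAt; _↑ˡ_) renaming (_≟_ to _≟ᶠ_)
open import Data.Bool using (Bool; true; false; if_then_else_; _∨_)
open import Data.List using (List; map; allFin)
open import Data.Nat.ListAction using (sum)
open import Data.Product using (Σ; ∃; _×_; _,_)
open import Data.Sum using (_⊎_; inj₁; inj₂)
open import Relation.Nullary using (¬_)
open import Relation.Nullary.Decidable using (⌊_⌋)
open import Relation.Binary.PropositionalEquality using (_≡_; _≢_; refl)
open import Function.Definitions using (Injective; Bijective)
import Data.Nat as ℕ

record Graph : Set where
  field
    n     : ℕ
    adj   : Fin n → Fin n → Bool
    sym   : ∀ x y → adj x y ≡ adj y x
    irr   : ∀ x → adj x x ≡ false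
open Graph public

V : Graph → Set
V G = Fin (n G)

deg : (G : Graph) → V G → ℕ
deg G v = sum (map (λ w → if adj G v w then 1 else 0) (allFin (n G)))

record TwoRooted : Set where
  field
    H      : Graph
    s      : V H
    t      : V H
    s≤t    : deg H s ≤ deg H t
open TwoRooted public

IsPathLabelling : (G : Graph) → (Fin (n G) → V G) → Set
IsPathLabelling G σ =
  Bijective _≡_ _≡_ σ ×
  (∀ i j → adj G (σ i) (σ j) ≡
             (⌊ suc (toℕ i) ℕ.≟ toℕ j ⌋ ∨ ⌊ suc (toℕ j) ℕ.≟ toℕ i ⌋))

IsEndpoint : (G : Graph) → (Fin (n G) → V G) → V G → Set
IsEndpoint G σ v = ∃ λ i → v ≡ σ i × (toℕ i ≡ 0 ⊎ suc (toℕ i) ≡ n G)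

OneEndpointRootedPath : TwoRooted → Set
OneEndpointRootedPath R =
  Σ (Fin (n (H R)) → V (H R)) λ σ →
    IsPathLabelling (H R) σ ×
    (IsEndpoint (H R) σ (s R) ⊎ IsEndpoint (H R) σ (t R))

IsCopy : (R : TwoRooted) (G : Graph) → (V (H R) → V G) → Set
IsCopy R G f = Injective _≡_ _≡_ f ×
               (∀ i j → adj G (f i) (f j) ≡ adj (H R) i j)

-- An extension (H', s', t') of the copy given by f.
-- s' (resp. t') is outside the image, and its unique neighbour in
-- H' = G[im f ∪ {s', t'}] is f ŝ (resp. f t̂).
Extension : (R : TwoRooted) (G : Graph) → (V (H R) → V G) → Set
Extension R G f =
  Σ (V G) λ s' → Σ (V G) λ t' →
    s' ≢ t' ×
    (∀ i → f i ≢ s') × (∀ i → f i ≢ t') ×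
    adj G s' (f (s R)) ≡ true ×
    (∀ i → adj G s' (f i) ≡ true → f i ≡ f (s R)) ×
    adj G t' (f (t R)) ≡ true ×
    (∀ i → adj G t' (f i) ≡ true → f i ≡ f (t R)) ×
    adj G s' t' ≡ false

Simplicial : (R : TwoRooted) (G : Graph) → (V (H R) → V G) → Set
Simplicial R G f = ¬ Extension R G f

HasSimplicialCopy : TwoRooted → Graph → Set
HasSimplicialCopy R G = Σ (V (H R) → V G) λ f → IsCopy R G f × Simplicial R G f

-- Adding a pendant edges at a vertex u (new vertices n, …, n + a - 1).

pendAdj : ∀ {m a} → (Fin m → Fin m → Bool) → Fin m →
          Fin m ⊎ Fin a → Fin m ⊎ Fin a → Bool
pendAdj A u (inj₁ x) (inj₁ y) = A x y
pendAdj A u (inj₁ x) (inj₂ _) = ⌊ x ≟ᶠ u ⌋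
pendAdj A u (inj₂ _) (inj₁ y) = ⌊ y ≟ᶠ u ⌋
pendAdj A u (inj₂ _) (inj₂ _) = false

pendAdj-sym : ∀ {m a} (A : Fin m → Fin m → Bool) u →
              (∀ x y → A x y ≡ A y x) →
              (p q : Fin m ⊎ Fin a) → pendAdj A u p q ≡ pendAdj A u q p
pendAdj-sym A u sy (inj₁ x) (inj₁ y) = sy x y
pendAdj-sym A u sy (inj₁ x) (inj₂ _) = refl
pendAdj-sym A u sy (inj₂ _) (inj₁ y) = refl
pendAdj-sym A u sy (inj₂ _) (inj₂ _) = refl

pendAdj-irr : ∀ {m a} (A : Fin m → Fin m → Bool) u →
              (∀ x → A x x ≡ false) →
              (p : Fin m ⊎ Fin a) → pendAdj A u p p ≡ false
pendAdj-irr A u ir (inj₁ x) = ir x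
pendAdj-irr A u ir (inj₂ _) = refl

addPendants : (G : Graph) → V G → ℕ → Graph
addPendants G u a = record
  { n   = n G + a
  ; adj = λ x y → pendAdj {a = a} (adj G) u (splitAt (n G) x) (splitAt (n G) y)
  ; sym = λ x y → pendAdj-sym (adj G) u (sym G) (splitAt (n G) x) (splitAt (n G) y)
  ; irr = λ x → pendAdj-irr (adj G) u (irr G) (splitAt (n G) x)
  }

addPendants₂ : (G : Graph) → V G → V G → ℕ → ℕ → Graph
addPendants₂ G u w a b = addPendants (addPendants G u a) (w ↑ˡ a) b

incl₂ : (G : Graph) (a b : ℕ) → V G → Fin ((n G + a) + b)
incl₂ G a b x = (x ↑ˡ a) ↑ˡ b

-- Pendant extensions and PE-sequences.
-- (PEReach R G) : G is the last term of a finite initial segment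
-- G₀ = Ĥ, G₁, …, G of a PE-sequence of R.

PEStepOK : (R : TwoRooted) (G : Graph) (f : V (H R) → V G) (a b : ℕ) → Set
PEStepOK R G f a b =
  Extension R (addPendants₂ G (f (s R)) (f (t R)) a b) (λ i → incl₂ G a b (f i)) ×
  (∀ a' b' → a' + b' < a + b →
     Simplicial R (addPendants₂ G (f (s R)) (f (t R)) a' b') (λ i → incl₂ G a' b' (f i)))

data PEReach (R : TwoRooted) : Graph → Set where
  start : PEReach R (H R)
  step  : ∀ {G} → PEReach R G →
          (f : V (H R) → V G) → IsCopy R G f → Simplicial R G f →
          (a b : ℕ) → PEStepOK R G f a b →
          PEReach R (addPendants₂ G (f (s R)) (f (t R)) a b)

-- A finite PE-sequence: a reachable G with no simplicial copy (the
-- sequence must stop there).  PE-inherent: no PE-sequence is finite.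
FinitePESeq : TwoRooted → Set
FinitePESeq R = Σ Graph λ G → PEReach R G × ¬ HasSimplicialCopy R G

PEInherent : TwoRooted → Set
PEInherent R = ¬ FinitePESeq R

-- Index the path from its rooted endpoint.  Every graph of a PE-sequence then
-- contains an induced copy of the path whose end (index 0) has no neighbour off
-- the copy, except a single one when the path is a single vertex.  This survives
-- adding pendant edges anywhere: pendants elsewhere do not touch the end, and
-- pendants at the end let the copy slide one step onto a fresh leaf.  An
-- extension of this copy attaches a new neighbour at the end, which forces the
-- path to be a single vertex; then both roots sit at the end and the extension
-- would attach two distinct neighbours there.  So the copy is always simplicial
-- and no PE-sequence terminates.
module Submission where

open import Defs hiding (sym)
open import Data.Nat using (ℕ; zero; suc; _+_)
import Data.Nat as ℕ
open import Data.Nat.Properties using (+-suc; +-cancelˡ-≡; +-cancelʳ-≡; m∸n+n≡m; n∸n≡0; suc-injective)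
open import Data.Fin using (Fin; zero; suc; toℕ; splitAt; _↑ˡ_; _↑ʳ_; inject₁; opposite) renaming (_≟_ to _≟ᶠ_)
open import Data.Fin.Properties using (toℕ-injective; toℕ<n; toℕ-inject₁; inject₁-injective; ↑ˡ-injective; splitAt-↑ˡ; splitAt-↑ʳ; splitAt⁻¹-↑ˡ; splitAt⁻¹-↑ʳ; opposite-prop; opposite-involutive; 0≢1+n)
open import Data.Bool using (Bool; true; false; _∨_)
open import Data.Bool.Properties using (∨-comm; T-≡)
open import Data.Product using (Σ; ∃; _×_; _,_; proj₁; proj₂)
open import Data.Sum using (_⊎_; inj₁; inj₂)
open import Data.Empty using (⊥-elim)
open import Function using (_∘_; _⇔_; mk⇔; Equivalence; Inverse)
open import Function.Bundles using (mk⤖)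
open import Function.Definitions using (Injective; Bijective)
open import Function.Properties.Bijection using (⤖⇒↔)
import Function.Construct.Composition as Compose
open import Relation.Nullary using (yes; no)
open import Relation.Nullary.Decidable using (⌊_⌋; isYes≗does; does-⇔; dec-true; dec-false; toWitness)
open import Relation.Binary.PropositionalEquality

⌊≟⌋-cong : ∀ {a b c d : ℕ} → a ≡ b ⇔ c ≡ d → ⌊ a ℕ.≟ b ⌋ ≡ ⌊ c ℕ.≟ d ⌋
⌊≟⌋-cong {a} {b} {c} {d} eq⇔eq =
  trans (isYes≗does (a ℕ.≟ b)) (trans (does-⇔ eq⇔eq (a ℕ.≟ b) (c ℕ.≟ d)) (sym (isYes≗does (c ℕ.≟ d))))

module _ {k} {x y : Fin k} where
  ⌊≟ᶠ⌋-true : x ≡ y → ⌊ x ≟ᶠ y ⌋ ≡ true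
  ⌊≟ᶠ⌋-true x≡y = trans (isYes≗does (x ≟ᶠ y)) (dec-true (x ≟ᶠ y) x≡y)

  ⌊≟ᶠ⌋-false : x ≢ y → ⌊ x ≟ᶠ y ⌋ ≡ false
  ⌊≟ᶠ⌋-false x≢y = trans (isYes≗does (x ≟ᶠ y)) (dec-false (x ≟ᶠ y) x≢y)

  ⌊≟ᶠ⌋-sound : ⌊ x ≟ᶠ y ⌋ ≡ true → x ≡ y
  ⌊≟ᶠ⌋-sound e = toWitness (Equivalence.from T-≡ e)

consecutive : ℕ → ℕ → Bool
consecutive x y = ⌊ suc x ℕ.≟ y ⌋ ∨ ⌊ suc y ℕ.≟ x ⌋

consecutive-comm : ∀ x y → consecutive x y ≡ consecutive y x
consecutive-comm x y = ∨-comm ⌊ suc x ℕ.≟ y ⌋ ⌊ suc y ℕ.≟ x ⌋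

consecutive-suc : ∀ x y → consecutive (suc x) (suc y) ≡ consecutive x y
consecutive-suc x y = cong₂ _∨_ (⌊≟⌋-cong (suc≡suc⇔ (suc x) y)) (⌊≟⌋-cong (suc≡suc⇔ (suc y) x))
  where
  suc≡suc⇔ : ∀ m m′ → suc m ≡ suc m′ ⇔ m ≡ m′
  suc≡suc⇔ _ _ = mk⇔ suc-injective (cong suc)

pathAdj : ∀ {k} → Fin k → Fin k → Bool
pathAdj i j = consecutive (toℕ i) (toℕ j)

opposite-+ : ∀ {k} (i : Fin k) → toℕ (opposite i) + suc (toℕ i) ≡ k
opposite-+ i = trans (cong (_+ suc (toℕ i)) (opposite-prop i)) (m∸n+n≡m (toℕ<n i))

opposite-successor : ∀ {k} (i j : Fin k) →
                     suc (toℕ (opposite i)) ≡ toℕ (opposite j) ⇔ suc (toℕ j) ≡ toℕ i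
opposite-successor {k} i j = mk⇔ to from
  where
  oi = toℕ (opposite i)
  oj = toℕ (opposite j)
  open ≡-Reasoning
  to : suc oi ≡ oj → suc (toℕ j) ≡ toℕ i
  to e = sym (suc-injective (+-cancelˡ-≡ oi _ _ (begin
    oi + suc (toℕ i)       ≡⟨ opposite-+ i ⟩
    k                      ≡⟨ sym (opposite-+ j) ⟩
    oj + suc (toℕ j)       ≡⟨ cong (_+ suc (toℕ j)) (sym e) ⟩
    suc oi + suc (toℕ j)   ≡⟨ sym (+-suc oi (suc (toℕ j))) ⟩
    oi + suc (suc (toℕ j)) ∎)))
  from : suc (toℕ j) ≡ toℕ i → suc oi ≡ oj
  from e = sym (+-cancelʳ-≡ (suc (toℕ j)) _ _ (begin
    oj + suc (toℕ j)       ≡⟨ opposite-+ j ⟩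
    k                      ≡⟨ sym (opposite-+ i) ⟩
    oi + suc (toℕ i)       ≡⟨ cong (λ x → oi + suc x) (sym e) ⟩
    oi + suc (suc (toℕ j)) ≡⟨ +-suc oi (suc (toℕ j)) ⟩
    suc oi + suc (toℕ j)   ∎))

pathAdj-opposite : ∀ {k} (i j : Fin k) → pathAdj (opposite i) (opposite j) ≡ pathAdj i j
pathAdj-opposite i j =
  trans (cong₂ _∨_ (⌊≟⌋-cong (opposite-successor i j)) (⌊≟⌋-cong (opposite-successor j i)))
        (consecutive-comm (toℕ j) (toℕ i))

opposite-bijective : ∀ {k} → Bijective _≡_ _≡_ (opposite {k})
opposite-bijective = injective , λ y → opposite y , λ { refl → opposite-involutive y }
  where
  injective : Injective _≡_ _≡_ opposite
  injective {x} {y} e =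
    trans (sym (opposite-involutive x)) (trans (cong opposite e) (opposite-involutive y))

IsPathLabelling-opposite : ∀ {G σ} → IsPathLabelling G σ → IsPathLabelling G (σ ∘ opposite)
IsPathLabelling-opposite (bijective , adjacency) =
  Compose.bijective _≡_ _≡_ _≡_ opposite-bijective bijective ,
  λ i j → trans (adjacency (opposite i) (opposite j)) (pathAdj-opposite i j)

endpoint-at-zero : ∀ {G σ v} → IsPathLabelling G σ → IsEndpoint G σ v →
                   Σ (Fin (n G) → V G) λ σ′ → IsPathLabelling G σ′ ×
                     Σ (Fin (n G)) λ z → toℕ z ≡ 0 × σ′ z ≡ v
endpoint-at-zero labelling (i , v≡σi , inj₁ first) = _ , labelling , i , first , sym v≡σi
endpoint-at-zero {G} {σ} labelling (i , v≡σi , inj₂ last) =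
  _ , IsPathLabelling-opposite {G} labelling , opposite i ,
  trans (opposite-prop i) (trans (cong (n G ℕ.∸_) last) (n∸n≡0 (n G))) ,
  trans (cong σ (opposite-involutive i)) (sym v≡σi)

data PendantView (m a : ℕ) : Fin (m + a) → Set where
  old : (y : Fin m) → PendantView m a (y ↑ˡ a)
  new : (z : Fin a) → PendantView m a (m ↑ʳ z)

pendantView : ∀ m a (x : Fin (m + a)) → PendantView m a x
pendantView m a x with splitAt m x in eq
... | inj₁ y = subst (PendantView m a) (splitAt⁻¹-↑ˡ eq) (old y)
... | inj₂ z = subst (PendantView m a) (splitAt⁻¹-↑ʳ eq) (new z)

module Pendants (G : Graph) (u : V G) (a : ℕ) where
  G⁺ : Graph
  G⁺ = addPendants G u a

  adj-old-old : ∀ x y → adj G⁺ (x ↑ˡ a) (y ↑ˡ a) ≡ adj G x y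
  adj-old-old x y = cong₂ (pendAdj (adj G) u) (splitAt-↑ˡ (n G) x a) (splitAt-↑ˡ (n G) y a)

  adj-old-new : ∀ x z → adj G⁺ (x ↑ˡ a) (n G ↑ʳ z) ≡ ⌊ x ≟ᶠ u ⌋
  adj-old-new x z = cong₂ (pendAdj (adj G) u) (splitAt-↑ˡ (n G) x a) (splitAt-↑ʳ (n G) a z)

  adj-new-old : ∀ z y → adj G⁺ (n G ↑ʳ z) (y ↑ˡ a) ≡ ⌊ y ≟ᶠ u ⌋
  adj-new-old z y = cong₂ (pendAdj (adj G) u) (splitAt-↑ʳ (n G) a z) (splitAt-↑ˡ (n G) y a)

  adj-new-new : ∀ z w → adj G⁺ (n G ↑ʳ z) (n G ↑ʳ w) ≡ false
  adj-new-new z w = cong₂ (pendAdj (adj G) u) (splitAt-↑ʳ (n G) a z) (splitAt-↑ʳ (n G) a w)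

  old≢new : ∀ x z → x ↑ˡ a ≢ n G ↑ʳ z
  old≢new x z e with trans (sym (splitAt-↑ˡ (n G) x a)) (trans (cong (splitAt (n G)) e) (splitAt-↑ʳ (n G) a z))
  ... | ()

  neighbour-of-new : ∀ {v} z → adj G⁺ v (n G ↑ʳ z) ≡ true → v ≡ u ↑ˡ a
  neighbour-of-new {v} z v~z with pendantView (n G) a v
  ... | old y = cong (_↑ˡ a) (⌊≟ᶠ⌋-sound (trans (sym (adj-old-new y z)) v~z))
  ... | new w with () ← trans (sym (adj-new-new w z)) v~z

  neighbour-of-old : ∀ {v} y → adj G⁺ v (y ↑ˡ a) ≡ true →
                     (∃ λ y′ → v ≡ y′ ↑ˡ a × adj G y′ y ≡ true) ⊎ (Fin a × y ≡ u)
  neighbour-of-old {v} y v~y with pendantView (n G) a v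
  ... | old y′ = inj₁ (y′ , refl , trans (sym (adj-old-old y′ y)) v~y)
  ... | new z  = inj₂ (z , ⌊≟ᶠ⌋-sound (trans (sym (adj-new-old z y)) v~y))

Fin-singleton : ∀ {k} → (∀ (j : Fin k) → toℕ j ≢ 0) → (i : Fin (suc k)) → i ≡ zero
Fin-singleton _       zero    = refl
Fin-singleton no-zero (suc zero)    = ⊥-elim (no-zero zero refl)
Fin-singleton no-zero (suc (suc _)) = ⊥-elim (no-zero zero refl)

IsInducedPath : (G : Graph) {k : ℕ} → (Fin k → V G) → Set
IsInducedPath G h = Injective _≡_ _≡_ h × (∀ i j → adj G (h i) (h j) ≡ pathAdj i j)

OutsideNeighbour : (G : Graph) {k : ℕ} → (Fin k → V G) → V G → V G → Set
OutsideNeighbour G h x v = (∀ i → h i ≢ v) × adj G v x ≡ true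

IsFreeEnd : (G : Graph) {k : ℕ} → (Fin k → V G) → Fin k → Set
IsFreeEnd G h z = ∀ v → OutsideNeighbour G h (h z) v →
                  (∀ i → i ≡ z) × (∀ w → OutsideNeighbour G h (h z) w → w ≡ v)

IsFreeEnd-unique : ∀ {G k} {h : Fin k → V G} {z v w i} → IsFreeEnd G h z →
                   OutsideNeighbour G h (h z) v → (∀ j → h j ≢ w) → adj G w (h i) ≡ true → w ≡ v
IsFreeEnd-unique {G} {h = h} {w = w} {i} end v-neighbour w-out w~hi with end _ v-neighbour
... | single , unique = unique w (w-out , subst (λ j → adj G w (h j) ≡ true) (single i) w~hi)

record FreeEndedPath (G : Graph) (k : ℕ) : Set where
  field
    vertex   : Fin k → V G
    induced  : IsInducedPath G vertex
    -- stated for every index of value 0, since the empty path has no index zero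
    free-end : ∀ z → toℕ z ≡ 0 → IsFreeEnd G vertex z

labelling⇒FreeEndedPath : ∀ {G σ} → IsPathLabelling G σ → FreeEndedPath G (n G)
labelling⇒FreeEndedPath {σ = σ} ((injective , surjective) , adjacency) = record
  { vertex   = σ
  ; induced  = injective , adjacency
  ; free-end = λ _ _ v (v-out , _) → ⊥-elim (v-out _ (proj₂ (surjective v) refl))
  }

module _ (G : Graph) (u : V G) (a : ℕ) where
  open Pendants G u a

  pendants-away-from-end : ∀ {k} (P : FreeEndedPath G (suc k)) →
                           (Fin a → FreeEndedPath.vertex P zero ≢ u) → FreeEndedPath G⁺ (suc k)
  pendants-away-from-end {k} P off-end = record
    { vertex = h⁺ ; induced = injective , adjacency ; free-end = end }
    where
    open FreeEndedPath P
    h⁺ : Fin (suc k) → V G⁺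
    h⁺ i = vertex i ↑ˡ a
    injective : Injective _≡_ _≡_ h⁺
    injective e = proj₁ induced (↑ˡ-injective a _ _ e)
    adjacency : ∀ i j → adj G⁺ (h⁺ i) (h⁺ j) ≡ pathAdj i j
    adjacency i j = trans (adj-old-old (vertex i) (vertex j)) (proj₂ induced i j)
    descend : ∀ {v} → OutsideNeighbour G⁺ h⁺ (h⁺ zero) v →
              ∃ λ y → v ≡ y ↑ˡ a × OutsideNeighbour G vertex (vertex zero) y
    descend (v-out , v~end) with neighbour-of-old (vertex zero) v~end
    ... | inj₁ (y , refl , y~end) = y , refl , (λ i e → v-out i (cong (_↑ˡ a) e)) , y~end
    ... | inj₂ (z , end≡u)        = ⊥-elim (off-end z end≡u)
    end : ∀ z → toℕ z ≡ 0 → IsFreeEnd G⁺ h⁺ z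
    end zero _ v v-neighbour with descend v-neighbour
    ... | y , refl , y-neighbour with free-end zero refl y y-neighbour
    ...   | single , unique = single , λ w w-neighbour →
            let y′ , w≡y′ , y′-neighbour = descend w-neighbour
            in trans w≡y′ (cong (_↑ˡ a) (unique y′ y′-neighbour))

  pendants-at-end : ∀ {k} (P : FreeEndedPath G (suc k)) →
                    FreeEndedPath.vertex P zero ≡ u → Fin a → FreeEndedPath G⁺ (suc k)
  pendants-at-end {k} P end≡u ℓ = record
    { vertex = h⁺ ; induced = injective , adjacency ; free-end = end }
    where
    open FreeEndedPath P
    -- the leaf ℓ followed by the old path without its last vertex
    h⁺ : Fin (suc k) → V G⁺
    h⁺ zero    = n G ↑ʳ ℓ
    h⁺ (suc i) = vertex (inject₁ i) ↑ˡ a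
    injective : Injective _≡_ _≡_ h⁺
    injective {zero}  {zero}  _ = refl
    injective {zero}  {suc j} e = ⊥-elim (old≢new _ ℓ (sym e))
    injective {suc i} {zero}  e = ⊥-elim (old≢new _ ℓ e)
    injective {suc i} {suc j} e = cong suc (inject₁-injective (proj₁ induced (↑ˡ-injective a _ _ e)))
    leaf-adjacency : ∀ j → ⌊ vertex (inject₁ j) ≟ᶠ u ⌋ ≡ pathAdj zero (suc j)
    leaf-adjacency zero    = ⌊≟ᶠ⌋-true end≡u
    leaf-adjacency (suc j) = ⌊≟ᶠ⌋-false λ e → 0≢1+n (sym (proj₁ induced (trans e (sym end≡u))))
    open ≡-Reasoning
    adjacency : ∀ i j → adj G⁺ (h⁺ i) (h⁺ j) ≡ pathAdj i j
    adjacency zero    zero    = adj-new-new ℓ ℓ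
    adjacency zero    (suc j) = trans (adj-new-old ℓ _) (leaf-adjacency j)
    adjacency (suc i) zero    =
      trans (adj-old-new _ ℓ) (trans (leaf-adjacency i) (consecutive-comm 0 (suc (toℕ i))))
    adjacency (suc i) (suc j) = begin
      adj G⁺ (vertex (inject₁ i) ↑ˡ a) (vertex (inject₁ j) ↑ˡ a) ≡⟨ adj-old-old _ _ ⟩
      adj G (vertex (inject₁ i)) (vertex (inject₁ j))           ≡⟨ proj₂ induced _ _ ⟩
      pathAdj (inject₁ i) (inject₁ j)                           ≡⟨ cong₂ consecutive (toℕ-inject₁ i) (toℕ-inject₁ j) ⟩
      pathAdj i j                                               ≡⟨ sym (consecutive-suc (toℕ i) (toℕ j)) ⟩
      pathAdj (suc i) (suc j)                                   ∎
    end : ∀ z → toℕ z ≡ 0 → IsFreeEnd G⁺ h⁺ z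
    end zero _ v (v-out , v~leaf) = single , λ w (_ , w~leaf) → trans (neighbour-of-new ℓ w~leaf) (sym v≡u)
      where
      v≡u : v ≡ u ↑ˡ a
      v≡u = neighbour-of-new ℓ v~leaf
      first-is-end : ∀ j → toℕ j ≡ 0 → vertex (inject₁ j) ≡ vertex zero
      first-is-end j j≡0 = cong vertex (toℕ-injective (trans (toℕ-inject₁ j) j≡0))
      single : ∀ i → i ≡ zero
      single = Fin-singleton λ j j≡0 →
        v-out (suc j) (trans (cong (_↑ˡ a) (trans (first-is-end j j≡0) end≡u)) (sym v≡u))

addPendants-FreeEndedPath : ∀ {G k} u a → FreeEndedPath G k → FreeEndedPath (addPendants G u a) k
addPendants-FreeEndedPath {k = zero} u a P = record
  { vertex = λ () ; induced = (λ { {()} }) , (λ ()) ; free-end = λ () }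
addPendants-FreeEndedPath {G} {suc k} u a P with FreeEndedPath.vertex P zero ≟ᶠ u | a
... | no end≢u  | a′     = pendants-away-from-end G u a′ P (λ _ → end≢u)
... | yes _     | zero   = pendants-away-from-end G u zero P (λ ())
... | yes end≡u | suc a′ = pendants-at-end G u (suc a′) P end≡u zero

data PendantGrowth (G₀ : Graph) : Graph → Set where
  here : PendantGrowth G₀ G₀
  grow : ∀ {G} → PendantGrowth G₀ G → ∀ u a → PendantGrowth G₀ (addPendants G u a)

PEReach⇒PendantGrowth : ∀ {R G} → PEReach R G → PendantGrowth (H R) G
PEReach⇒PendantGrowth start = here
PEReach⇒PendantGrowth {R} (step reach f _ _ a b _) =
  grow (grow (PEReach⇒PendantGrowth reach) (f (s R)) a) (f (t R) ↑ˡ a) b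

PendantGrowth-FreeEndedPath : ∀ {G₀ G k} → PendantGrowth G₀ G → FreeEndedPath G₀ k → FreeEndedPath G k
PendantGrowth-FreeEndedPath here           P = P
PendantGrowth-FreeEndedPath (grow g u a) P = addPendants-FreeEndedPath u a (PendantGrowth-FreeEndedPath g P)

module _ (R : TwoRooted) {σ : Fin (n (H R)) → V (H R)} (labelling : IsPathLabelling (H R) σ) where
  open Inverse (⤖⇒↔ (mk⤖ (proj₁ labelling))) using (strictlyInverseˡ; strictlyInverseʳ)
    renaming (from to σ⁻¹)

  FreeEndedPath⇒HasSimplicialCopy : ∀ {G z} → toℕ z ≡ 0 → σ z ≡ s R ⊎ σ z ≡ t R →
                                    FreeEndedPath G (n (H R)) → HasSimplicialCopy R G
  FreeEndedPath⇒HasSimplicialCopy {G} {z} z≡0 root P = copy , (injective , adjacency) , simplicial root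
    where
    open FreeEndedPath P
    copy : V (H R) → V G
    copy = vertex ∘ σ⁻¹
    injective : Injective _≡_ _≡_ copy
    injective {x} {y} e =
      trans (sym (strictlyInverseˡ x)) (trans (cong σ (proj₁ induced e)) (strictlyInverseˡ y))
    adjacency : ∀ x y → adj G (copy x) (copy y) ≡ adj (H R) x y
    adjacency x y = trans (proj₂ induced (σ⁻¹ x) (σ⁻¹ y))
      (trans (sym (proj₂ labelling (σ⁻¹ x) (σ⁻¹ y)))
             (cong₂ (adj (H R)) (strictlyInverseˡ x) (strictlyInverseˡ y)))
    off-path : ∀ {v} → (∀ x → copy x ≢ v) → ∀ i → vertex i ≢ v
    off-path v-out i e = v-out (σ i) (trans (cong vertex (strictlyInverseʳ i)) e)
    at-end : ∀ {v x} → σ z ≡ x → adj G v (copy x) ≡ true → adj G v (vertex z) ≡ true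
    at-end {v} refl v~x = subst (λ i → adj G v (vertex i) ≡ true) (strictlyInverseʳ z) v~x
    end : IsFreeEnd G vertex z
    end = free-end z z≡0
    simplicial : σ z ≡ s R ⊎ σ z ≡ t R → Simplicial R G copy
    simplicial (inj₁ z-is-s) (s′ , t′ , s′≢t′ , s′-out , t′-out , s′~s , _ , t′~t , _) =
      s′≢t′ (sym (IsFreeEnd-unique {G} end (off-path s′-out , at-end z-is-s s′~s) (off-path t′-out) t′~t))
    simplicial (inj₂ z-is-t) (s′ , t′ , s′≢t′ , s′-out , t′-out , s′~s , _ , t′~t , _) =
      s′≢t′ (IsFreeEnd-unique {G} end (off-path t′-out , at-end z-is-t t′~t) (off-path s′-out) s′~s)

root-at-zero : ∀ {R} → OneEndpointRootedPath R →
               Σ (Fin (n (H R)) → V (H R)) λ σ → IsPathLabelling (H R) σ ×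
                 Σ (Fin (n (H R))) λ z → toℕ z ≡ 0 × (σ z ≡ s R ⊎ σ z ≡ t R)
root-at-zero {R} (_ , labelling , inj₁ s-end) with endpoint-at-zero {H R} labelling s-end
... | σ , labelling′ , z , z≡0 , z-is-s = σ , labelling′ , z , z≡0 , inj₁ z-is-s
root-at-zero {R} (_ , labelling , inj₂ t-end) with endpoint-at-zero {H R} labelling t-end
... | σ , labelling′ , z , z≡0 , z-is-t = σ , labelling′ , z , z≡0 , inj₂ z-is-t

corollary3p33 : (R : TwoRooted) → OneEndpointRootedPath R → PEInherent R
corollary3p33 R rooted (G , reach , no-simplicial-copy) with root-at-zero {R} rooted
... | σ , labelling , z , z≡0 , root =
  no-simplicial-copy (FreeEndedPath⇒HasSimplicialCopy R labelling z≡0 root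
    (PendantGrowth-FreeEndedPath (PEReach⇒PendantGrowth reach) (labelling⇒FreeEndedPath {H R} labelling)))
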